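{- Let $C$ be a clutter on a finite vertex set $V$. If for every subclutter $S\subseteq C$ the partition $\lambda(S)$ is odd, then $C$ is eulerian.
   Context: A clutter $C$ on $V$ is a collection of subsets of $V$ (edges), each of size at least two, forming an antichain under inclusion; it is discrete if it has no edges. For a subclutter $S\subseteq C$, $\lambda(S)$ is the partition of $|V|$ whose parts are the numbers of vertices of the connected components of the hypergraph $(V,S)$ (vertices not covered by $S$ form singleton components). A partition is odd if all its parts are odd. The restriction to $I\subseteq V$ is $C|_I=\{e\in C:e\subseteq I\}$. Let $\zeta(C)=1$ if $C$ is discrete and $0$ otherwise, $\epsilon(C)=1$ if $V=\emptyset$ and $0$ otherwise, and $\chi(C)=\sum_{I\subseteq V}(-1)^{|I|}\zeta(C|_I)\zeta(C|_{V\setminus I})$. $C$ is eulerian if $\chi(C|_I)=\epsilon(C|_I)$ for all $I\subseteq V$. -}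

module Defs where

open import Data.Nat using (ℕ; zero; suc; _≤_; _%_)
open import Data.Integer using (ℤ; +_; -_; _*_; _+_)
open import Data.Bool using (true; false)
open import Data.Fin using (Fin)
open import Data.Fin.Subset using (Subset; _∈_; _⊆_; ∣_∣; _∩_; ∁; outside; inside)
open import Data.Fin.Subset.Properties using (_⊆?_)
open import Data.List using (List; []; _∷_; filter; map; foldr; null)
open import Data.List.Membership.Propositional renaming (_∈_ to _∈ₗ_)
open import Data.List.Relation.Unary.Unique.Propositional using (Unique)
open import Data.Vec using ([]; _∷_)
open import Data.Product using (_×_)
open import Relation.Binary.PropositionalEquality using (_≡_)
open import Relation.Nullary.Decidable using (does)
open import Data.Bool using (Bool; if_then_else_)
open import Function.Bundles using (_⇔_)
import Data.List.Relation.Binary.Sublist.Propositional as SL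

record IsClutter {n : ℕ} (C : List (Subset n)) : Set where
  field
    unique   : Unique C
    size≥2   : ∀ {e} → e ∈ₗ C → 2 ≤ ∣ e ∣
    antichain : ∀ {e f} → e ∈ₗ C → f ∈ₗ C → e ⊆ f → e ≡ f

-- Subclutter S ⊆ C (sublist of the duplicate-free edge list = subset of edges).
Subclutter : {n : ℕ} → List (Subset n) → List (Subset n) → Set
Subclutter S C = S SL.⊆ C

data Reach {n : ℕ} (S : List (Subset n)) : Fin n → Fin n → Set where
  here : ∀ {v} → Reach S v v
  step : ∀ {u w v} (e : Subset n) → e ∈ₗ S → u ∈ e → w ∈ e → Reach S w v → Reach S u v

IsComponentOf : {n : ℕ} → List (Subset n) → Fin n → Subset n → Set
IsComponentOf S v K = ∀ w → (w ∈ K) ⇔ Reach S v w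

Odd : ℕ → Set
Odd m = m % 2 ≡ 1

-- λ(S) is odd: every part of λ(S), i.e. the size of every connected component, is odd.
OddPartition : {n : ℕ} → List (Subset n) → Set
OddPartition {n} S = ∀ (v : Fin n) (K : Subset n) → IsComponentOf S v K → Odd ∣ K ∣

subsets : (n : ℕ) → List (Subset n)
subsets zero = [] ∷ []
subsets (suc n) = foldr (λ p acc → (outside ∷ p) ∷ (inside ∷ p) ∷ acc) [] (subsets n)

restrict : {n : ℕ} → List (Subset n) → Subset n → List (Subset n)
restrict C I = filter (λ e → e ⊆? I) C

ζ : {n : ℕ} → List (Subset n) → ℤ
ζ D = if null D then + 1 else + 0

ε : {n : ℕ} → Subset n → ℤ
ε I with ∣ I ∣
... | zero = + 1
... | suc _ = + 0

sign : ℕ → ℤ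
sign zero = + 1
sign (suc k) = - sign k

sumℤ : List ℤ → ℤ
sumℤ = foldr _+_ (+ 0)

-- χ of a clutter D on vertex set I (I ⊆ Fin n, edges of D contained in I):
-- χ(D) = Σ_{J ⊆ I} (-1)^{|J|} ζ(D|_J) ζ(D|_{I∖J}).
χ : {n : ℕ} → Subset n → List (Subset n) → ℤ
χ {n} I D =
  sumℤ (map (λ J → sign ∣ J ∣ * (ζ (restrict D J) * ζ (restrict D (I ∩ ∁ J))))
            (filter (λ J → J ⊆? I) (subsets n)))

Eulerian : {n : ℕ} → List (Subset n) → Set
Eulerian {n} C = ∀ (I : Subset n) → χ I (restrict C I) ≡ ε I

-- For I = ∅ there is nothing to prove beyond χ = 1, since a clutter has no edge inside ∅.
-- For I ≠ ∅ pick v ∈ I and let K be the connected component of v in C|_I; |K| is odd by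
-- hypothesis. Every edge of C|_I lies inside K or outside it, so the involution J ↦ J Δ K
-- of the subsets of I keeps the weight ζ(C|_J) ζ(C|_{I∖J}) (on K it swaps the two sides)
-- and flips the sign (-1)^|J|: the terms of χ(C|_I) cancel in pairs.
module Submission where

open import Defs
open import Data.Bool using (true; false; not; _∧_; _xor_; if_then_else_)
open import Data.Bool.Properties using (xor-assoc; xor-same; xor-identityʳ)
open import Data.Fin using (Fin; _≟_)
open import Data.Fin.Properties using (any?)
open import Data.Fin.Subset using (Subset; _∈_; _∉_; _⊆_; ∣_∣; _∩_; ∁; outside; inside; ⊥; ⁅_⁆; Nonempty)
open import Data.Fin.Subset.Properties
  using (_⊆?_; _∈?_; nonempty?; Empty-unique; ∉⊥; x∉p⇒x∈∁p; x∈∁p⇒x∉p; ∣⊥∣≡0; ∣⁅x⁆∣≡1; x∈⁅y⁆⇒x≡y; p⊆q⇒∣p∣≤∣q∣)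
open import Data.Integer using (ℤ; +_; -_; _+_; _*_; -1ℤ; +[1+_]; -[1+_])
import Data.Integer.Properties as ℤ
open import Data.Integer.Tactic.RingSolver using (solve-∀)
open import Data.List using (List; []; _∷_; map; filter; foldr)
open import Data.List.Properties using (map-cong; filter-none)
open import Data.List.Membership.Propositional using () renaming (_∈_ to _∈ₗ_)
open import Data.List.Membership.Propositional.Properties using (∈-filter⁻)
open import Data.List.Relation.Binary.Sublist.Propositional.Properties using (filter-⊆)
open import Data.List.Relation.Unary.Any using (here; there)
import Data.List.Relation.Unary.All as All
open import Data.Nat using (ℕ; zero; suc; _≤_; _<_)
open import Data.Nat.Properties using (≤-trans)
open import Data.Product using (∃; _×_; _,_; proj₁; proj₂)
open import Data.Sum using (_⊎_; inj₁; inj₂)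
import Data.Sum as Sum
open import Data.Vec using ([]; _∷_; lookup; zipWith; tabulate; tail)
open import Data.Vec.Properties using ([]=⇒lookup; lookup⇒[]=; lookup-zipWith; lookup-map; lookup∘tabulate)
open import Function using (_∘_)
open import Function.Bundles using (_⇔_; mk⇔; Equivalence)
open import Relation.Binary.PropositionalEquality
  using (_≡_; _≢_; refl; sym; trans; cong; cong₂; subst; module ≡-Reasoning)
open import Relation.Nullary using (Dec; yes; no; ¬_; does; contradiction)
open import Relation.Nullary.Decidable using (_×-dec_; _⊎-dec_; map′; does-⇔; dec-true; dec-false)
open import Relation.Unary using (Decidable)

open ≡-Reasoning

private
  variable
    n : ℕ
    u v w x : Fin n
    e p q I J K : Subset n
    S : List (Subset n)

∈⇒lookup : x ∈ p → lookup p x ≡ true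
∈⇒lookup = []=⇒lookup

lookup⇒∈ : lookup p x ≡ true → x ∈ p
lookup⇒∈ {p = p} {x = x} = lookup⇒[]= x p

∉⇒lookup : x ∉ p → lookup p x ≡ false
∉⇒lookup {x = x} {p = p} x∉p with lookup p x in eq
... | true  = contradiction (lookup⇒∈ eq) x∉p
... | false = refl

lookup-∩∁ : ∀ (p q : Subset n) x → lookup (p ∩ ∁ q) x ≡ lookup p x ∧ not (lookup q x)
lookup-∩∁ p q x = trans (lookup-zipWith _∧_ x p (∁ q)) (cong (lookup p x ∧_) (lookup-map x not q))

∈-tabulate-does : {P : Fin n → Set} (P? : Decidable P) → x ∈ tabulate (does ∘ P?) ⇔ P x
∈-tabulate-does {x = x} {P = P} P? = mk⇔ to from
  where
  to : x ∈ tabulate (does ∘ P?) → P x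
  to x∈ with P? x | trans (sym (lookup∘tabulate (does ∘ P?) x)) (∈⇒lookup x∈)
  ... | yes px | _ = px
  ... | no _   | ()
  from : P x → x ∈ tabulate (does ∘ P?)
  from px = lookup⇒∈ (trans (lookup∘tabulate (does ∘ P?) x) (dec-true (P? x) px))

⊆-agree : (∀ {x} → x ∈ e → lookup p x ≡ lookup q x) → e ⊆ p → e ⊆ q
⊆-agree agree e⊆p x∈e = lookup⇒∈ (trans (sym (agree x∈e)) (∈⇒lookup (e⊆p x∈e)))

⊆-agree⇔ : (∀ {x} → x ∈ e → lookup p x ≡ lookup q x) → e ⊆ p ⇔ e ⊆ q
⊆-agree⇔ agree = mk⇔ (⊆-agree agree) (⊆-agree (sym ∘ agree))

⊆⊥⇒≡⊥ : p ⊆ ⊥ → p ≡ ⊥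
⊆⊥⇒≡⊥ p⊆⊥ = Empty-unique λ (_ , x∈p) → ∉⊥ (p⊆⊥ x∈p)

0<∣p∣ : x ∈ p → 0 < ∣ p ∣
0<∣p∣ {x = x} {p = p} x∈p = subst (_≤ ∣ p ∣) (∣⁅x⁆∣≡1 x) (p⊆q⇒∣p∣≤∣q∣ ⁅x⁆⊆p)
  where
  ⁅x⁆⊆p : ⁅ x ⁆ ⊆ p
  ⁅x⁆⊆p y∈ with refl ← x∈⁅y⁆⇒x≡y x y∈ = x∈p

_Δ_ : Subset n → Subset n → Subset n
p Δ q = zipWith _xor_ p q

lookup-Δ : ∀ (p q : Subset n) x → lookup (p Δ q) x ≡ lookup p x xor lookup q x
lookup-Δ p q x = lookup-zipWith _xor_ x p q

Δ-involutive : ∀ (p q : Subset n) → (p Δ q) Δ q ≡ p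
Δ-involutive []      []      = refl
Δ-involutive (a ∷ p) (b ∷ q) = cong₂ _∷_ a⊕b⊕b≡a (Δ-involutive p q)
  where
  a⊕b⊕b≡a : (a xor b) xor b ≡ a
  a⊕b⊕b≡a = trans (xor-assoc a b b) (trans (cong (a xor_) (xor-same b)) (xor-identityʳ a))

Δ-⊆ : p ⊆ I → q ⊆ I → p Δ q ⊆ I
Δ-⊆ {p = p} {q = q} p⊆I q⊆I {x} x∈ with lookup p x in eq | trans (sym (lookup-Δ p q x)) (∈⇒lookup x∈)
... | true  | _    = p⊆I (lookup⇒∈ eq)
... | false | q[x] = q⊆I (lookup⇒∈ q[x])

Δ-⊆⇔ : K ⊆ I → J Δ K ⊆ I ⇔ J ⊆ I
Δ-⊆⇔ {K = K} {I = I} {J = J} K⊆I = mk⇔ to (λ J⊆I → Δ-⊆ J⊆I K⊆I)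
  where
  to : J Δ K ⊆ I → J ⊆ I
  to JΔK⊆I = subst (_⊆ I) (Δ-involutive J K) (Δ-⊆ JΔK⊆I K⊆I)

sign-Δ : ∀ (p q : Subset n) → sign ∣ p Δ q ∣ ≡ sign ∣ p ∣ * sign ∣ q ∣
sign-Δ []            []            = refl
sign-Δ (outside ∷ p) (outside ∷ q) = sign-Δ p q
sign-Δ (outside ∷ p) (inside  ∷ q) = trans (cong -_ (sign-Δ p q)) (ℤ.neg-distribʳ-* (sign ∣ p ∣) _)
sign-Δ (inside  ∷ p) (outside ∷ q) = trans (cong -_ (sign-Δ p q)) (ℤ.neg-distribˡ-* (sign ∣ p ∣) _)
sign-Δ (inside  ∷ p) (inside  ∷ q) = trans (sign-Δ p q) (neg*neg (sign ∣ p ∣) (sign ∣ q ∣))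
  where
  neg*neg : ∀ a b → a * b ≡ (- a) * (- b)
  neg*neg = solve-∀

-- (2 + m) % 2 reduces to m % 2, so odd-m serves for both m and 2 + m.
sign-odd : ∀ m → Odd m → sign m ≡ -1ℤ
sign-odd (suc zero)    _     = refl
sign-odd (suc (suc m)) odd-m = trans (ℤ.neg-involutive (sign m)) (sign-odd m odd-m)

sign-Δ-odd : ∀ (p q : Subset n) → Odd ∣ q ∣ → sign ∣ p Δ q ∣ ≡ - sign ∣ p ∣
sign-Δ-odd p q odd = begin
  sign ∣ p Δ q ∣          ≡⟨ sign-Δ p q ⟩
  sign ∣ p ∣ * sign ∣ q ∣ ≡⟨ cong (sign ∣ p ∣ *_) (sign-odd ∣ q ∣ odd) ⟩
  sign ∣ p ∣ * -1ℤ        ≡⟨ ℤ.*-comm (sign ∣ p ∣) -1ℤ ⟩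
  -1ℤ * sign ∣ p ∣        ≡⟨ ℤ.-1*i≡-i (sign ∣ p ∣) ⟩
  - sign ∣ p ∣            ∎

sumℤ-map-neg : ∀ {A : Set} (f : A → ℤ) xs → sumℤ (map (-_ ∘ f) xs) ≡ - sumℤ (map f xs)
sumℤ-map-neg f []       = refl
sumℤ-map-neg f (x ∷ xs) = trans (cong (_+_ (- f x)) (sumℤ-map-neg f xs)) (sym (ℤ.neg-distrib-+ (f x) _))

sumℤ-map-filter : ∀ {A : Set} {P : A → Set} (P? : Decidable P) (f : A → ℤ) xs →
  sumℤ (map f (filter P? xs)) ≡ sumℤ (map (λ x → if does (P? x) then f x else + 0) xs)
sumℤ-map-filter P? f []       = refl
sumℤ-map-filter P? f (x ∷ xs) with does (P? x)
... | true  = cong (_+_ (f x)) (sumℤ-map-filter P? f xs)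
... | false = trans (sumℤ-map-filter P? f xs) (sym (ℤ.+-identityˡ _))

sumSubsets : (n : ℕ) → (Subset n → ℤ) → ℤ
sumSubsets n f = sumℤ (map f (subsets n))

sumSubsets-suc : ∀ n (f : Subset (suc n) → ℤ) →
  sumSubsets (suc n) f ≡ sumSubsets n (f ∘ (outside ∷_)) + sumSubsets n (f ∘ (inside ∷_))
sumSubsets-suc n f = go (subsets n)
  where
  interchange : ∀ a b c d → a + (b + (c + d)) ≡ (a + c) + (b + d)
  interchange = solve-∀
  go : ∀ ps → sumℤ (map f (foldr (λ p acc → (outside ∷ p) ∷ (inside ∷ p) ∷ acc) [] ps))
            ≡ sumℤ (map (f ∘ (outside ∷_)) ps) + sumℤ (map (f ∘ (inside ∷_)) ps)
  go []       = refl
  go (p ∷ ps) rewrite go ps = interchange (f (outside ∷ p)) (f (inside ∷ p)) _ _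

sumSubsets-Δ : ∀ n (f : Subset n → ℤ) K → sumSubsets n (λ J → f (J Δ K)) ≡ sumSubsets n f
sumSubsets-Δ zero    f []      = refl
sumSubsets-Δ (suc n) f (b ∷ K) = begin
  sumSubsets (suc n) (λ J → f (J Δ (b ∷ K)))
    ≡⟨ sumSubsets-suc n (λ J → f (J Δ (b ∷ K))) ⟩
  sumSubsets n (λ J → f (b ∷ J Δ K)) + sumSubsets n (λ J → f (not b ∷ J Δ K))
    ≡⟨ cong₂ _+_ (sumSubsets-Δ n (f ∘ (b ∷_)) K) (sumSubsets-Δ n (f ∘ (not b ∷_)) K) ⟩
  sumSubsets n (f ∘ (b ∷_)) + sumSubsets n (f ∘ (not b ∷_))
    ≡⟨ halves b ⟩
  sumSubsets n (f ∘ (outside ∷_)) + sumSubsets n (f ∘ (inside ∷_))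
    ≡⟨ sumSubsets-suc n f ⟨
  sumSubsets (suc n) f ∎
  where
  halves : ∀ b → sumSubsets n (f ∘ (b ∷_)) + sumSubsets n (f ∘ (not b ∷_))
               ≡ sumSubsets n (f ∘ (outside ∷_)) + sumSubsets n (f ∘ (inside ∷_))
  halves false = refl
  halves true  = ℤ.+-comm (sumSubsets n (f ∘ (inside ∷_))) (sumSubsets n (f ∘ (outside ∷_)))

sumSubsets-antisymmetric : ∀ n (f : Subset n → ℤ) K → (∀ J → f (J Δ K) ≡ - f J) → sumSubsets n f ≡ + 0
sumSubsets-antisymmetric n f K f-anti = self-neg (begin
  sumSubsets n f                 ≡⟨ sumSubsets-Δ n f K ⟨
  sumSubsets n (λ J → f (J Δ K)) ≡⟨ cong sumℤ (map-cong f-anti (subsets n)) ⟩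
  sumℤ (map (-_ ∘ f) (subsets n)) ≡⟨ sumℤ-map-neg f (subsets n) ⟩
  - sumSubsets n f               ∎)
  where
  self-neg : ∀ {i} → i ≡ - i → i ≡ + 0
  self-neg {+ zero}       _  = refl
  self-neg {i = +[1+ _ ]} ()
  self-neg {i = -[1+ _ ]} ()

sumSubsets-⊥ : ∀ n (f : Subset n → ℤ) → (∀ J → J ≢ ⊥ → f J ≡ + 0) → sumSubsets n f ≡ f ⊥
sumSubsets-⊥ zero    f _        = ℤ.+-identityʳ (f [])
sumSubsets-⊥ (suc n) f f-vanish = begin
  sumSubsets (suc n) f
    ≡⟨ sumSubsets-suc n f ⟩
  sumSubsets n (f ∘ (outside ∷_)) + sumSubsets n (f ∘ (inside ∷_))
    ≡⟨ cong₂ _+_ (sumSubsets-⊥ n (f ∘ (outside ∷_)) (λ J J≢⊥ → f-vanish _ (J≢⊥ ∘ cong tail)))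
                 (sumSubsets-⊥ n (f ∘ (inside ∷_)) (λ J _ → f-vanish _ λ ())) ⟩
  f ⊥ + f (inside ∷ ⊥)
    ≡⟨ cong (_+_ (f ⊥)) (f-vanish _ λ ()) ⟩
  f ⊥ + + 0
    ≡⟨ ℤ.+-identityʳ (f ⊥) ⟩
  f ⊥ ∎

reach-trans : Reach S u v → Reach S v w → Reach S u w
reach-trans here                   r = r
reach-trans (step e e∈S u∈e w∈e r) s = step e e∈S u∈e w∈e (reach-trans r s)

reach-weaken : Reach S u w → Reach (e ∷ S) u w
reach-weaken here                   = here
reach-weaken (step f f∈S u∈f w∈f r) = step f (there f∈S) u∈f w∈f (reach-weaken r)

-- This makes Reach decidable by recursion on S: a walk in e ∷ S either avoids e or can be
-- rerouted to enter and leave e only once.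
ReachVia : List (Subset n) → Subset n → Fin n → Fin n → Set
ReachVia S e u w = (∃ λ a → a ∈ e × Reach S u a) × (∃ λ b → b ∈ e × Reach S b w)

reach-∷⁺ : Reach S u w ⊎ ReachVia S e u w → Reach (e ∷ S) u w
reach-∷⁺ (inj₁ r) = reach-weaken r
reach-∷⁺ (inj₂ ((a , a∈e , r) , (b , b∈e , s))) =
  reach-trans (reach-weaken r) (step _ (here refl) a∈e b∈e (reach-weaken s))

reach-∷⁻ : Reach (e ∷ S) u w → Reach S u w ⊎ ReachVia S e u w
reach-∷⁻ here = inj₁ here
reach-∷⁻ {u = u} (step _ (here refl) u∈e w∈e r) with reach-∷⁻ r
... | inj₁ s            = inj₂ ((u , u∈e , here) , (_ , w∈e , s))
... | inj₂ (_ , leave)  = inj₂ ((u , u∈e , here) , leave)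
reach-∷⁻ (step f (there f∈S) u∈f w∈f r) with reach-∷⁻ r
... | inj₁ s                        = inj₁ (step f f∈S u∈f w∈f s)
... | inj₂ ((a , a∈e , s) , leave)  = inj₂ ((a , a∈e , step f f∈S u∈f w∈f s) , leave)

reach? : ∀ (S : List (Subset n)) u w → Dec (Reach S u w)
reach? [] u w = map′ (λ { refl → here }) (λ { here → refl ; (step _ () _ _ _) }) (u ≟ w)
reach? (e ∷ S) u w = map′ reach-∷⁺ reach-∷⁻
  (reach? S u w ⊎-dec (any? (λ a → a ∈? e ×-dec reach? S u a) ×-dec any? (λ b → b ∈? e ×-dec reach? S b w)))

component : ∀ (S : List (Subset n)) v → ∃ (IsComponentOf S v)
component S v = tabulate (does ∘ reach? S v) , λ w → ∈-tabulate-does (reach? S v)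

module _ {K : Subset n} (K-comp : IsComponentOf S v K) where

  component-closed : e ∈ₗ S → x ∈ e → x ∈ K → e ⊆ K
  component-closed e∈S x∈e x∈K y∈e = Equivalence.from (K-comp _)
    (reach-trans (Equivalence.to (K-comp _) x∈K) (step _ e∈S x∈e y∈e here))

  component-separates : e ∈ₗ S → e ⊆ K ⊎ e ⊆ ∁ K
  component-separates {e = e} e∈S with any? (λ x → x ∈? e ×-dec x ∈? K)
  ... | yes (x , x∈e , x∈K) = inj₁ (component-closed e∈S x∈e x∈K)
  ... | no  e∩K-empty       = inj₂ λ y∈e → x∉p⇒x∈∁p λ y∈K → e∩K-empty (_ , y∈e , y∈K)

  component-⊆ : (∀ {e} → e ∈ₗ S → e ⊆ I) → v ∈ I → K ⊆ I
  component-⊆ {I = I} S⊆I v∈I w∈K = walk v∈I (Equivalence.to (K-comp _) w∈K)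
    where
    walk : u ∈ I → Reach S u w → w ∈ I
    walk u∈I here                 = u∈I
    walk u∈I (step e e∈S _ w∈e r) = walk (S⊆I e∈S w∈e) r

filter-cong : ∀ {A : Set} {P Q : A → Set} (P? : Decidable P) (Q? : Decidable Q) xs →
  (∀ {x} → x ∈ₗ xs → P x ⇔ Q x) → filter P? xs ≡ filter Q? xs
filter-cong P? Q? []       _   = refl
filter-cong P? Q? (x ∷ xs) P⇔Q with P? x | Q? x
... | yes _  | yes _  = cong (x ∷_) (filter-cong P? Q? xs (P⇔Q ∘ there))
... | no  _  | no  _  = filter-cong P? Q? xs (P⇔Q ∘ there)
... | yes px | no ¬qx = contradiction (Equivalence.to (P⇔Q (here refl)) px) ¬qx
... | no ¬px | yes qx = contradiction (Equivalence.from (P⇔Q (here refl)) qx) ¬px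

ζ*ζ-filter : ∀ {P Q : Subset n → Set} (P? : Decidable P) (Q? : Decidable Q) D →
  ζ (filter P? D) * ζ (filter Q? D) ≡ ζ (filter (λ e → P? e ⊎-dec Q? e) D)
ζ*ζ-filter P? Q? []      = refl
ζ*ζ-filter P? Q? (e ∷ D) with P? e | Q? e
... | yes _ | _     = ℤ.*-zeroˡ (ζ (filter Q? (e ∷ D)))
... | no  _ | yes _ = ℤ.*-zeroʳ (ζ (filter P? D))
... | no  _ | no  _ = ζ*ζ-filter P? Q? D

Monochromatic : Subset n → Subset n → Subset n → Set
Monochromatic I J e = e ⊆ J ⊎ e ⊆ I ∩ ∁ J

monochromatic? : ∀ (I J : Subset n) → Decidable (Monochromatic I J)
monochromatic? I J e = e ⊆? J ⊎-dec e ⊆? (I ∩ ∁ J)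

module _ (I J K : Subset n) {x : Fin n} (x∈I : x ∈ I) where

  lookup-Δ-inside : x ∈ K →
    lookup (J Δ K) x ≡ lookup (I ∩ ∁ J) x × lookup (I ∩ ∁ (J Δ K)) x ≡ lookup J x
  lookup-Δ-inside x∈K
    rewrite lookup-∩∁ I (J Δ K) x | lookup-Δ J K x | lookup-∩∁ I J x | ∈⇒lookup x∈I | ∈⇒lookup x∈K
    with lookup J x
  ... | true  = refl , refl
  ... | false = refl , refl

  lookup-Δ-outside : x ∉ K →
    lookup (J Δ K) x ≡ lookup J x × lookup (I ∩ ∁ (J Δ K)) x ≡ lookup (I ∩ ∁ J) x
  lookup-Δ-outside x∉K
    rewrite lookup-∩∁ I (J Δ K) x | lookup-Δ J K x | lookup-∩∁ I J x | ∉⇒lookup x∉K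
    = xor-identityʳ (lookup J x) , cong (λ j → lookup I x ∧ not j) (xor-identityʳ (lookup J x))

monochromatic-Δ : ∀ (I J K : Subset n) → e ⊆ I → e ⊆ K ⊎ e ⊆ ∁ K →
  Monochromatic I (J Δ K) e ⇔ Monochromatic I J e
monochromatic-Δ {e = e} I J K e⊆I (inj₁ e⊆K) = mk⇔
  (Sum.swap ∘ Sum.map (Equivalence.to left) (Equivalence.to right))
  (Sum.map (Equivalence.from left) (Equivalence.from right) ∘ Sum.swap)
  where
  left : e ⊆ J Δ K ⇔ e ⊆ I ∩ ∁ J
  left  = ⊆-agree⇔ (λ x∈e → proj₁ (lookup-Δ-inside I J K (e⊆I x∈e) (e⊆K x∈e)))
  right : e ⊆ I ∩ ∁ (J Δ K) ⇔ e ⊆ J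
  right = ⊆-agree⇔ (λ x∈e → proj₂ (lookup-Δ-inside I J K (e⊆I x∈e) (e⊆K x∈e)))
monochromatic-Δ {e = e} I J K e⊆I (inj₂ e⊆∁K) = mk⇔
  (Sum.map (Equivalence.to left) (Equivalence.to right))
  (Sum.map (Equivalence.from left) (Equivalence.from right))
  where
  left : e ⊆ J Δ K ⇔ e ⊆ J
  left  = ⊆-agree⇔ (λ x∈e → proj₁ (lookup-Δ-outside I J K (e⊆I x∈e) (x∈∁p⇒x∉p (e⊆∁K x∈e))))
  right : e ⊆ I ∩ ∁ (J Δ K) ⇔ e ⊆ I ∩ ∁ J
  right = ⊆-agree⇔ (λ x∈e → proj₂ (lookup-Δ-outside I J K (e⊆I x∈e) (x∈∁p⇒x∉p (e⊆∁K x∈e))))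

χ-odd-separator : ∀ (I K : Subset n) (D : List (Subset n)) →
  (∀ {e} → e ∈ₗ D → e ⊆ I) → (∀ {e} → e ∈ₗ D → e ⊆ K ⊎ e ⊆ ∁ K) → K ⊆ I → Odd ∣ K ∣ →
  χ I D ≡ + 0
χ-odd-separator {n} I K D D⊆I separated K⊆I odd = begin
  χ I D                                                       ≡⟨ sumℤ-map-filter (_⊆? I) term (subsets n) ⟩
  sumSubsets n (λ J → if does (J ⊆? I) then term J else + 0) ≡⟨ sumSubsets-antisymmetric n _ K antisymmetric ⟩
  + 0                                                         ∎
  where
  weight : Subset n → ℤ
  weight J = ζ (restrict D J) * ζ (restrict D (I ∩ ∁ J))

  term : Subset n → ℤ
  term J = sign ∣ J ∣ * weight J

  weight-Δ : ∀ J → weight (J Δ K) ≡ weight J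
  weight-Δ J = begin
    weight (J Δ K)                          ≡⟨ ζ*ζ-filter (_⊆? (J Δ K)) (_⊆? (I ∩ ∁ (J Δ K))) D ⟩
    ζ (filter (monochromatic? I (J Δ K)) D) ≡⟨ cong ζ (filter-cong _ _ D λ e∈D →
                                                 monochromatic-Δ I J K (D⊆I e∈D) (separated e∈D)) ⟩
    ζ (filter (monochromatic? I J) D)       ≡⟨ ζ*ζ-filter (_⊆? J) (_⊆? (I ∩ ∁ J)) D ⟨
    weight J                                ∎

  term-Δ : ∀ J → term (J Δ K) ≡ - term J
  term-Δ J = begin
    sign ∣ J Δ K ∣ * weight (J Δ K) ≡⟨ cong₂ _*_ (sign-Δ-odd J K odd) (weight-Δ J) ⟩
    - sign ∣ J ∣ * weight J         ≡⟨ ℤ.neg-distribˡ-* (sign ∣ J ∣) (weight J) ⟨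
    - term J                        ∎

  antisymmetric : ∀ J → (if does (J Δ K ⊆? I) then term (J Δ K) else + 0)
                      ≡ - (if does (J ⊆? I) then term J else + 0)
  antisymmetric J rewrite does-⇔ (Δ-⊆⇔ {J = J} K⊆I) (J Δ K ⊆? I) (J ⊆? I) with does (J ⊆? I)
  ... | true  = term-Δ J
  ... | false = refl

χ-⊥ : χ (⊥ {n}) [] ≡ + 1
χ-⊥ {n} = begin
  χ (⊥ {n}) []        ≡⟨ sumℤ-map-filter (_⊆? ⊥) (λ J → sign ∣ J ∣ * + 1) (subsets n) ⟩
  sumSubsets n term   ≡⟨ sumSubsets-⊥ n term term-vanishes ⟩
  term ⊥              ≡⟨ term-⊥ ⟩
  + 1                 ∎
  where
  term : Subset n → ℤ
  term J = if does (J ⊆? ⊥) then sign ∣ J ∣ * + 1 else + 0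

  term-vanishes : ∀ J → J ≢ ⊥ → term J ≡ + 0
  term-vanishes J J≢⊥ rewrite dec-false (J ⊆? ⊥) (J≢⊥ ∘ ⊆⊥⇒≡⊥) = refl

  term-⊥ : term ⊥ ≡ + 1
  term-⊥ rewrite dec-true (⊥ {n} ⊆? ⊥) (λ x∈⊥ → x∈⊥) | ∣⊥∣≡0 n = refl

ε-⊥ : ε (⊥ {n}) ≡ + 1
ε-⊥ {n} rewrite ∣⊥∣≡0 n = refl

ε-nonempty : Nonempty I → ε I ≡ + 0
ε-nonempty {I = I} (_ , x∈I) with ∣ I ∣ | 0<∣p∣ x∈I
... | suc _ | _ = refl

restrict-⊥ : ∀ {C : List (Subset n)} → IsClutter C → restrict C ⊥ ≡ []
restrict-⊥ {n} {C} clutter = filter-none (_⊆? ⊥) (All.tabulate no-edge-in-⊥)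
  where
  no-edge-in-⊥ : ∀ {e} → e ∈ₗ C → ¬ e ⊆ ⊥
  no-edge-in-⊥ {e} e∈C e⊆⊥
    with () ← ≤-trans (IsClutter.size≥2 clutter e∈C) (subst (∣ e ∣ ≤_) (∣⊥∣≡0 n) (p⊆q⇒∣p∣≤∣q∣ e⊆⊥))

mainTheorem6 : (n : ℕ) (C : List (Subset n)) → IsClutter C →
    (∀ (S : List (Subset n)) → Subclutter S C → OddPartition S) →
    Eulerian C
mainTheorem6 n C clutter oddλ I with nonempty? I
... | no I-empty rewrite Empty-unique I-empty | restrict-⊥ clutter = trans (χ-⊥ {n}) (sym (ε-⊥ {n}))
... | yes (v , v∈I) with component (restrict C I) v
...   | K , K-comp = begin
  χ I D ≡⟨ χ-odd-separator I K D D⊆I (component-separates K-comp) (component-⊆ K-comp D⊆I v∈I) K-odd ⟩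
  + 0   ≡⟨ ε-nonempty (v , v∈I) ⟨
  ε I   ∎
  where
  D : List (Subset n)
  D = restrict C I
  D⊆I : ∀ {e} → e ∈ₗ D → e ⊆ I
  D⊆I e∈D = proj₂ (∈-filter⁻ (_⊆? I) {xs = C} e∈D)
  K-odd : Odd ∣ K ∣
  K-odd = oddλ D (filter-⊆ (_⊆? I) C) v K K-comp
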